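{- Let $n\ge 1$ and let $\pi\in S_n$ avoid the classical pattern $231$. Let $I_1,\dots,I_k$ be the inverse descent runs of $\pi$, indexed so that $\max(I_1)>\max(I_2)>\dots>\max(I_k)$. Then for every $i\in[n]$: $i$ is an ascent of $\pi$ (that is, $i<n$ and $\pi_i<\pi_{i+1}$) if and only if there exists $j$ with $1<j\le k$ such that $i=\max(I_j)$.
   Context: $[n]=\{1,\dots,n\}$, $S_n$ is the set of permutations of $[n]$ written in one-line notation $\pi=\pi_1\cdots\pi_n$, with positions indexed from $1$. A permutation $\pi$ avoids the classical pattern $231$ if there are no indices $a<b<c$ with $\pi_c<\pi_a<\pi_b$. For a permutation $\tau\in S_n$, a descent run of $\tau$ is a set of consecutive positions $\{i,i+1,\dots,j\}\subseteq[n]$ with $\tau_i>\tau_{i+1}>\dots>\tau_j$ that is maximal (it cannot be extended by $i-1\ge1$ or $j+1\le n$ while keeping the decreasing property). For $\pi\in S_n$ with inverse $\pi^{ -1}$, an inverse descent run of $\pi$ is a set $I\subseteq[n]$ such that $\pi(I)=\{\pi_i: i\in I\}$ is a descent run of $\pi^{ -1}$. The inverse descent runs of $\pi$ partition $[n]$. -}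

module Defs where

open import Data.Nat using (ℕ; suc)
open import Data.Fin using (Fin; toℕ; _<_; _≤_)
open import Data.Fin.Subset using (Subset; _∈_)
open import Data.Fin.Permutation using (Permutation′; _⟨$⟩ʳ_; _⟨$⟩ˡ_)
open import Data.Product using (Σ; ∃; ∃-syntax; _×_)
open import Relation.Nullary using (¬_)
open import Relation.Binary.PropositionalEquality using (_≡_)
open import Function.Bundles using (_⇔_)

-- Positions and values are 0-indexed elements of Fin n
-- (position p : Fin n corresponds to position toℕ p + 1 of the paper).
-- A permutation π ∈ S_n is an element of  Permutation′ n  (= Permutation n n, a bijection Fin n ↔ Fin n);
-- π_i is  π ⟨$⟩ʳ i  and  π⁻¹_i  is  π ⟨$⟩ˡ i.

Avoids231 : ∀ {n} → Permutation′ n → Set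
Avoids231 {n} π =
  ¬ (Σ (Fin n) λ a → Σ (Fin n) λ b → Σ (Fin n) λ c →
       a < b × b < c × (π ⟨$⟩ʳ c) < (π ⟨$⟩ʳ a) × (π ⟨$⟩ʳ a) < (π ⟨$⟩ʳ b))

IsAscent : ∀ {n} → Permutation′ n → Fin n → Set
IsAscent {n} π i =
  Σ (Fin n) λ i' → toℕ i' ≡ suc (toℕ i) × (π ⟨$⟩ʳ i) < (π ⟨$⟩ʳ i')

IsDescentRun : ∀ {n} → (Fin n → Fin n) → Subset n → Set
IsDescentRun {n} τ D =
  Σ (Fin n) λ i → Σ (Fin n) λ j →
    i ≤ j
    × (∀ x → (x ∈ D) ⇔ (i ≤ x × x ≤ j))
    × (∀ x y → toℕ y ≡ suc (toℕ x) → i ≤ x → y ≤ j → τ y < τ x)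
    × (∀ x → toℕ i ≡ suc (toℕ x) → ¬ (τ i < τ x))
    × (∀ y → toℕ y ≡ suc (toℕ j) → ¬ (τ y < τ j))

IsInvDescentRun : ∀ {n} → Permutation′ n → Subset n → Set
IsInvDescentRun {n} π I =
  Σ (Subset n) λ D →
    IsDescentRun (π ⟨$⟩ˡ_) D
    × (∀ y → (y ∈ D) ⇔ (Σ (Fin n) λ x → x ∈ I × (π ⟨$⟩ʳ x) ≡ y))

IsMax : ∀ {n} → Subset n → Fin n → Set
IsMax I m = m ∈ I × (∀ x → x ∈ I → x ≤ m)

-- I : Fin k → Subset n lists the inverse descent runs of π as I_1,…,I_k
-- (index j : Fin k is I_{toℕ j + 1}), with max(I_1) > max(I_2) > … > max(I_k).
IsOrderedInvDescentRuns : ∀ {n k} → Permutation′ n → (Fin k → Subset n) → Set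
IsOrderedInvDescentRuns {n} {k} π I =
  (∀ j → IsInvDescentRun π (I j))
  × (∀ S → IsInvDescentRun π S → Σ (Fin k) λ j → I j ≡ S)
  × (∀ j j' m m' → j < j' → IsMax (I j) m → IsMax (I j') m' → m' < m)

{-# OPTIONS --safe #-}
-- Write τ = π⁻¹. The inverse descent run containing position i is the preimage of the descent
-- run of τ through the value π_i, and its maximum is τ of the smallest value of that run; so i is
-- the maximum of its run exactly when the value π_i − 1 does not lie to the right of i. For a
-- 231-avoiding π and i < n this is equivalent to π_i < π_{i+1}: the value π_i − 1 to the right of
-- an ascent, or to the left of a descent, would complete a 231. Finally the first run has the
-- largest maximum, which is n, so the maxima of the other runs are exactly the run maxima below n.
module Submission where

open import Defs
open import Data.Empty using (⊥-elim)
open import Data.Fin using (Fin; toℕ)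
open import Data.Fin.Base as Fin using (fromℕ<; inject₁)
open import Data.Fin.Permutation using (Permutation′; _⟨$⟩ʳ_; _⟨$⟩ˡ_; inverseˡ; inverseʳ)
open import Data.Fin.Properties as Fin using (toℕ-fromℕ<; fromℕ<-toℕ; toℕ-injective; toℕ<n; toℕ-inject₁)
open import Data.Fin.Subset using (Subset; _∈_)
open import Data.Fin.Subset.Properties using (_∈?_)
open import Data.Nat using (ℕ; _≤_)
open import Data.Nat.Base using (zero; suc; _+_; _<_; z≤n; s≤s; s≤s⁻¹; _≤′_; ≤′-refl; ≤′-step)
open import Data.Nat.Properties
  using (≤-refl; ≤-reflexive; ≤-trans; <⇒≤; <⇒≱; ≮⇒≥; ≤-<-trans; <-trans; n<1+n; +-suc; m≤m+n;
         m≤n⇒m≤1+n; m<1+n⇒m<n∨m≡n; m≤n⇒m<n∨m≡n; ≤⇒≤′; ≤′⇒≤; ≤∧≢⇒<; <-irrefl; 1+n≢n; _<?_)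
open import Data.Product using (Σ; _×_; _,_; proj₁; proj₂)
open import Data.Sum using (inj₁; inj₂)
open import Data.Vec.Base using (tabulate)
open import Data.Vec.Properties using (lookup∘tabulate; []=⇒lookup; lookup⇒[]=)
open import Function.Base using (_∘_)
open import Function.Bundles using (_⇔_; mk⇔; Equivalence)
open import Relation.Binary.PropositionalEquality using (_≡_; refl; sym; trans; cong; subst; subst₂)
open import Relation.Nullary using (¬_; yes; no; does; proof)
open import Relation.Nullary.Decidable using (_×-dec_; dec-true)
open import Relation.Nullary.Reflects using (Reflects; invert)
open import Relation.Unary using (Pred; Decidable)

open Equivalence using (to; from)

module _ {p} {P : Pred ℕ p} (P? : Decidable P) where

  maximalBlockBelow : ∀ v → Σ ℕ λ s →
    s ≤ v × (∀ x → s ≤ x → x < v → P x) × (∀ x → suc x ≡ s → ¬ P x)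
  maximalBlockBelow zero = zero , z≤n , (λ _ _ ()) , (λ _ ())
  maximalBlockBelow (suc v) with P? v
  ... | no ¬Pv = suc v , ≤-refl , (λ x sv≤x x<sv → ⊥-elim (<⇒≱ x<sv sv≤x)) , λ { _ refl → ¬Pv }
  ... | yes Pv =
    let s , s≤v , block , atStart = maximalBlockBelow v in
    s , m≤n⇒m≤1+n s≤v , snoc block , atStart
    where
    snoc : ∀ {s} → (∀ x → s ≤ x → x < v → P x) → ∀ x → s ≤ x → x < suc v → P x
    snoc block x s≤x x<sv with m<1+n⇒m<n∨m≡n x<sv
    ... | inj₁ x<v = block x s≤x x<v
    ... | inj₂ refl = Pv

  maximalBlockAbove : ∀ {b} → (∀ x → P x → suc x < b) → ∀ {v} → v < b → Σ ℕ λ e →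
    v ≤ e × e < b × (∀ x → v ≤ x → x < e → P x) × ¬ P e
  maximalBlockAbove {b} bounded {v} v<b = go b v v<b (m≤m+n b v)
    where
    cons : ∀ {v e} → P v → (∀ x → suc v ≤ x → x < e → P x) → ∀ x → v ≤ x → x < e → P x
    cons Pv block x v≤x x<e with m≤n⇒m<n∨m≡n v≤x
    ... | inj₁ v<x = block x v<x x<e
    ... | inj₂ refl = Pv

    go : ∀ fuel v → v < b → b ≤ fuel + v → Σ ℕ λ e →
      v ≤ e × e < b × (∀ x → v ≤ x → x < e → P x) × ¬ P e
    go fuel v v<b _ with P? v
    ... | no ¬Pv = v , ≤-refl , v<b , (λ x v≤x x<v → ⊥-elim (<⇒≱ x<v v≤x)) , ¬Pv
    go zero v v<b b≤v | yes _ = ⊥-elim (<⇒≱ v<b b≤v)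
    go (suc fuel) v _ b≤ | yes Pv =
      let e , sv≤e , e<b , block , atEnd =
            go fuel (suc v) (bounded v Pv) (subst (b ≤_) (sym (+-suc fuel v)) b≤) in
      e , <⇒≤ sv≤e , e<b , cons Pv block , atEnd

decreasingOn⇒≤first : ∀ (g : ℕ → ℕ) {s e} → (∀ x → s ≤ x → x < e → g (suc x) < g x) →
  ∀ {w} → s ≤ w → w ≤ e → g w ≤ g s
decreasingOn⇒≤first g {s} {e} decreasing s≤w = go (≤⇒≤′ s≤w)
  where
  go : ∀ {w} → s ≤′ w → w ≤ e → g w ≤ g s
  go ≤′-refl _ = ≤-refl
  go (≤′-step {w} s≤′w) sw≤e =
    ≤-trans (<⇒≤ (decreasing w (≤′⇒≤ s≤′w) sw≤e)) (go s≤′w (<⇒≤ sw≤e))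

fromDec : ∀ {n p} {P : Pred (Fin n) p} → Decidable P → Subset n
fromDec P? = tabulate (does ∘ P?)

∈-fromDec : ∀ {n p} {P : Pred (Fin n) p} (P? : Decidable P) {x} → x ∈ fromDec P? ⇔ P x
∈-fromDec {P = P} P? {x} = mk⇔
  (λ x∈ → invert (subst (Reflects (P x)) (trans (sym (lookup∘tabulate _ x)) ([]=⇒lookup x∈))
                        (proof (P? x))))
  (λ Px → lookup⇒[]= x _ (trans (lookup∘tabulate _ x) (dec-true (P? x) Px)))

predecessor : ∀ {n} (v : Fin n) → 0 < toℕ v → Σ (Fin n) λ u → toℕ v ≡ suc (toℕ u)
predecessor (Fin.suc u) _ = inject₁ u , cong suc (sym (toℕ-inject₁ u))

IsMax-unique : ∀ {n} {S : Subset n} {m m′} → IsMax S m → IsMax S m′ → m ≡ m′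
IsMax-unique (m∈S , m-max) (m′∈S , m′-max) = Fin.≤-antisym (m′-max _ m∈S) (m-max _ m′∈S)

module DescentRuns {n} (τ : Fin n → Fin n) where

  -- τ read as a sequence indexed by ℕ. Its value at positions ≥ n is a junk 0, which is why
  -- Descent also asks for suc x < n.
  valueAt : ℕ → ℕ
  valueAt x with x <? n
  ... | yes x<n = toℕ (τ (fromℕ< x<n))
  ... | no _ = 0

  valueAt-fromℕ< : ∀ {x} (x<n : x < n) → valueAt x ≡ toℕ (τ (fromℕ< x<n))
  valueAt-fromℕ< {x} x<n with x <? n
  ... | yes _ = refl
  ... | no x≮n = ⊥-elim (x≮n x<n)

  valueAt-toℕ : ∀ x → valueAt (toℕ x) ≡ toℕ (τ x)
  valueAt-toℕ x = trans (valueAt-fromℕ< (toℕ<n x)) (cong (toℕ ∘ τ) (fromℕ<-toℕ x (toℕ<n x)))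

  Descent : ℕ → Set
  Descent x = suc x < n × valueAt (suc x) < valueAt x

  descent? : Decidable Descent
  descent? x = (suc x <? n) ×-dec (valueAt (suc x) <? valueAt x)

  descent⇒< : ∀ {x y} → toℕ y ≡ suc (toℕ x) → Descent (toℕ x) → τ y Fin.< τ x
  descent⇒< {x} {y} y≡1+x (_ , desc) =
    subst₂ _<_ (trans (cong valueAt (sym y≡1+x)) (valueAt-toℕ y)) (valueAt-toℕ x) desc

  <⇒descent : ∀ {x y} → toℕ y ≡ suc (toℕ x) → τ y Fin.< τ x → Descent (toℕ x)
  <⇒descent {x} {y} y≡1+x τy<τx =
    subst (_< n) y≡1+x (toℕ<n y) ,
    subst₂ _<_ (trans (sym (valueAt-toℕ y)) (cong valueAt y≡1+x)) (sym (valueAt-toℕ x)) τy<τx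

  NoDescentBelow : Fin n → Set
  NoDescentBelow v = ∀ x → toℕ v ≡ suc (toℕ x) → ¬ (τ v Fin.< τ x)

  runStart : ∀ {D} → IsDescentRun τ D → Fin n
  runStart = proj₁

  runStart-noDescentBelow : ∀ {D} (r : IsDescentRun τ D) → NoDescentBelow (runStart r)
  runStart-noDescentBelow (_ , _ , _ , _ , _ , atStart , _) = atStart

  runStart∈ : ∀ {D} (r : IsDescentRun τ D) → runStart r ∈ D
  runStart∈ (_ , _ , s≤e , mem , _) = from (mem _) (≤-refl , s≤e)

  runStart-unique : ∀ {D} (r : IsDescentRun τ D) {v} → v ∈ D → NoDescentBelow v → runStart r ≡ v
  runStart-unique (s , e , _ , mem , desc , _) {v} v∈D noDescent
    with s≤v , v≤e ← to (mem v) v∈D | m≤n⇒m<n∨m≡n s≤v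
  ... | inj₂ s≡v = toℕ-injective s≡v
  ... | inj₁ s<v =
    let u , v≡1+u = predecessor v (≤-<-trans z≤n s<v) in
    ⊥-elim (noDescent u v≡1+u (desc u v v≡1+u (s≤s⁻¹ (subst (toℕ s <_) v≡1+u s<v)) v≤e))

  descentRun-≤start : ∀ {D} (r : IsDescentRun τ D) {y} → y ∈ D → τ y Fin.≤ τ (runStart r)
  descentRun-≤start (s , e , _ , mem , desc , _) {y} y∈D =
    let s≤y , y≤e = to (mem y) y∈D in
    subst₂ _≤_ (valueAt-toℕ y) (valueAt-toℕ s) (decreasingOn⇒≤first valueAt decreasing s≤y y≤e)
    where
    decreasing : ∀ x → toℕ s ≤ x → x < toℕ e → valueAt (suc x) < valueAt x
    decreasing x s≤x x<e =
      proj₂ (subst Descent (toℕ-fromℕ< x<n) (<⇒descent q≡1+p (desc p q q≡1+p s≤p q≤e)))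
      where
      1+x<n : suc x < n
      1+x<n = ≤-<-trans x<e (toℕ<n e)
      x<n : x < n
      x<n = <-trans (n<1+n x) 1+x<n
      p q : Fin n
      p = fromℕ< x<n
      q = fromℕ< 1+x<n
      q≡1+p : toℕ q ≡ suc (toℕ p)
      q≡1+p = trans (toℕ-fromℕ< 1+x<n) (cong suc (sym (toℕ-fromℕ< x<n)))
      s≤p : s Fin.≤ p
      s≤p = subst (toℕ s ≤_) (sym (toℕ-fromℕ< x<n)) s≤x
      q≤e : q Fin.≤ e
      q≤e = subst (_≤ toℕ e) (sym (toℕ-fromℕ< 1+x<n)) x<e

  between? : ∀ (s e : Fin n) → Decidable {A = Fin n} (λ x → s Fin.≤ x × x Fin.≤ e)
  between? s e x = (s Fin.≤? x) ×-dec (x Fin.≤? e)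

  descentRunThrough : ∀ v → Σ (Subset n) λ D → IsDescentRun τ D × v ∈ D
  descentRunThrough v
    with maximalBlockBelow descent? (toℕ v) | maximalBlockAbove descent? (λ _ → proj₁) (toℕ<n v)
  ... | s′ , s′≤v , below , stopBelow | e′ , v≤e′ , e′<n , above , stopAbove =
    fromDec (between? s e) ,
    (s , e , s≤e , (λ _ → ∈-fromDec (between? s e)) , desc , atStart , atEnd) ,
    from (∈-fromDec (between? s e))
      (subst (_≤ toℕ v) (sym s≡s′) s′≤v , subst (toℕ v ≤_) (sym e≡e′) v≤e′)
    where
    s e : Fin n
    s = fromℕ< (≤-<-trans s′≤v (toℕ<n v))
    e = fromℕ< e′<n
    s≡s′ : toℕ s ≡ s′
    s≡s′ = toℕ-fromℕ< _
    e≡e′ : toℕ e ≡ e′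
    e≡e′ = toℕ-fromℕ< e′<n
    s≤e : s Fin.≤ e
    s≤e = subst₂ _≤_ (sym s≡s′) (sym e≡e′) (≤-trans s′≤v v≤e′)
    descents : ∀ x → s′ ≤ x → x < e′ → Descent x
    descents x s′≤x x<e′ with x <? toℕ v
    ... | yes x<v = below x s′≤x x<v
    ... | no x≮v = above x (≮⇒≥ x≮v) x<e′
    desc : ∀ x y → toℕ y ≡ suc (toℕ x) → s Fin.≤ x → y Fin.≤ e → τ y Fin.< τ x
    desc x y y≡1+x s≤x y≤e =
      descent⇒< y≡1+x (descents (toℕ x) (subst (_≤ toℕ x) s≡s′ s≤x) (subst₂ _≤_ y≡1+x e≡e′ y≤e))
    atStart : NoDescentBelow s
    atStart x s≡1+x τs<τx = stopBelow (toℕ x) (trans (sym s≡1+x) s≡s′) (<⇒descent s≡1+x τs<τx)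
    atEnd : ∀ y → toℕ y ≡ suc (toℕ e) → ¬ (τ y Fin.< τ e)
    atEnd y y≡1+e τy<τe = stopAbove (subst Descent e≡e′ (<⇒descent y≡1+e τy<τe))

module InverseRuns {n} (π : Permutation′ n) where

  open DescentRuns (π ⟨$⟩ˡ_)

  preimage? : ∀ D → Decidable {A = Fin n} (λ x → π ⟨$⟩ʳ x ∈ D)
  preimage? D x = π ⟨$⟩ʳ x ∈? D

  preimage-invRun : ∀ {D} → IsDescentRun (π ⟨$⟩ˡ_) D → IsInvDescentRun π (fromDec (preimage? D))
  preimage-invRun {D} r = D , r , λ y → mk⇔
    (λ y∈D → π ⟨$⟩ˡ y , from (∈-fromDec (preimage? D)) (subst (_∈ D) (sym (inverseʳ π)) y∈D) , inverseʳ π)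
    (λ (x , x∈S , πx≡y) → subst (_∈ D) πx≡y (to (∈-fromDec (preimage? D)) x∈S))

  invRunThrough : ∀ x → Σ (Subset n) λ S → IsInvDescentRun π S × x ∈ S
  invRunThrough x =
    let D , r , πx∈D = descentRunThrough (π ⟨$⟩ʳ x) in
    fromDec (preimage? D) , preimage-invRun r , from (∈-fromDec (preimage? D)) πx∈D

  invRunStart : ∀ {S} → IsInvDescentRun π S → Fin n
  invRunStart (_ , r , _) = runStart r

  invRun-max : ∀ {S} (ir : IsInvDescentRun π S) → IsMax S (π ⟨$⟩ˡ invRunStart ir)
  invRun-max {S} (D , r , mem) =
    let x , x∈S , πx≡s = to (mem _) (runStart∈ r) in
    subst (_∈ S) (trans (sym (inverseˡ π)) (cong (π ⟨$⟩ˡ_) πx≡s)) x∈S ,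
    λ y y∈S → subst (Fin._≤ _) (inverseˡ π) (descentRun-≤start r (from (mem _) (y , y∈S , refl)))

  invRun-max⇔noDescentBelow : ∀ {S} → IsInvDescentRun π S → ∀ {x} → x ∈ S →
    IsMax S x ⇔ NoDescentBelow (π ⟨$⟩ʳ x)
  invRun-max⇔noDescentBelow {S} ir@(D , r , mem) {x} x∈S = mk⇔
    (λ x-max → subst NoDescentBelow (start≡πx x-max) (runStart-noDescentBelow r))
    (λ noDescent → subst (IsMax S) (trans (cong (π ⟨$⟩ˡ_) (runStart-unique r πx∈D noDescent)) (inverseˡ π))
                         (invRun-max ir))
    where
    πx∈D : π ⟨$⟩ʳ x ∈ D
    πx∈D = from (mem _) (x , x∈S , refl)
    start≡πx : IsMax S x → runStart r ≡ π ⟨$⟩ʳ x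
    start≡πx x-max = trans (sym (inverseʳ π)) (cong (π ⟨$⟩ʳ_) (IsMax-unique (invRun-max ir) x-max))

module Avoiding231 {n} (π : Permutation′ n) (avoids : Avoids231 π) where

  open DescentRuns (π ⟨$⟩ˡ_) using (NoDescentBelow)

  -- NoDescentBelow (π ⟨$⟩ʳ i): the value π_i − 1 is absent or occurs to the left of position i.

  toℕ∘π-injective : ∀ {x y} → toℕ (π ⟨$⟩ʳ x) ≡ toℕ (π ⟨$⟩ʳ y) → x ≡ y
  toℕ∘π-injective eq = trans (sym (inverseˡ π)) (trans (cong (π ⟨$⟩ˡ_) (toℕ-injective eq)) (inverseˡ π))

  ascent⇒noDescentBelow : ∀ {i i′} → toℕ i′ ≡ suc (toℕ i) →
    π ⟨$⟩ʳ i Fin.< π ⟨$⟩ʳ i′ → NoDescentBelow (π ⟨$⟩ʳ i)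
  ascent⇒noDescentBelow {i} {i′} i′≡1+i πi<πi′ x πi≡1+x i<p =
    avoids (i , i′ , p , ≤-reflexive (sym i′≡1+i) , i′<p , πp<πi , πi<πi′)
    where
    p : Fin n
    p = π ⟨$⟩ˡ x
    πp<πi : π ⟨$⟩ʳ p Fin.< π ⟨$⟩ʳ i
    πp<πi = subst (λ z → toℕ z < toℕ (π ⟨$⟩ʳ i)) (sym (inverseʳ π)) (≤-reflexive (sym πi≡1+x))
    i′<p : toℕ i′ < toℕ p
    i′<p = ≤∧≢⇒< (subst (_≤ toℕ p) (trans (cong (suc ∘ toℕ) (inverseˡ π)) (sym i′≡1+i)) i<p)
      (λ i′≡p → <-irrefl (cong (toℕ ∘ (π ⟨$⟩ʳ_)) (sym (toℕ-injective i′≡p))) (<-trans πp<πi πi<πi′))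

  noDescentBelow⇒ascent : ∀ {i i′} → toℕ i′ ≡ suc (toℕ i) →
    NoDescentBelow (π ⟨$⟩ʳ i) → π ⟨$⟩ʳ i Fin.< π ⟨$⟩ʳ i′
  noDescentBelow⇒ascent {i} {i′} i′≡1+i noDescent with toℕ (π ⟨$⟩ʳ i′) <? toℕ (π ⟨$⟩ʳ i)
  ... | no πi′≮πi = ≤∧≢⇒< (≮⇒≥ πi′≮πi)
    λ πi≡πi′ → 1+n≢n (trans (sym i′≡1+i) (cong toℕ (sym (toℕ∘π-injective πi≡πi′))))
  ... | yes πi′<πi = ⊥-elim (avoids (p , i , i′ , p<i , ≤-reflexive (sym i′≡1+i) , πi′<πp , πp<πi))
    where
    x : Fin n
    x = proj₁ (predecessor (π ⟨$⟩ʳ i) (≤-<-trans z≤n πi′<πi))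
    πi≡1+x : toℕ (π ⟨$⟩ʳ i) ≡ suc (toℕ x)
    πi≡1+x = proj₂ (predecessor (π ⟨$⟩ʳ i) (≤-<-trans z≤n πi′<πi))
    p : Fin n
    p = π ⟨$⟩ˡ x
    πp≡x : π ⟨$⟩ʳ p ≡ x
    πp≡x = inverseʳ π
    p<i : toℕ p < toℕ i
    p<i = ≤∧≢⇒< (≮⇒≥ (λ i<p → noDescent x πi≡1+x (subst (λ z → toℕ z < toℕ p) (sym (inverseˡ π)) i<p)))
      (λ p≡i → 1+n≢n (trans (sym πi≡1+x)
                             (cong toℕ (trans (cong (π ⟨$⟩ʳ_) (sym (toℕ-injective p≡i))) πp≡x))))
    πp<πi : toℕ (π ⟨$⟩ʳ p) < toℕ (π ⟨$⟩ʳ i)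
    πp<πi = subst (λ z → toℕ z < toℕ (π ⟨$⟩ʳ i)) (sym πp≡x) (≤-reflexive (sym πi≡1+x))
    πi′<πp : toℕ (π ⟨$⟩ʳ i′) < toℕ (π ⟨$⟩ʳ p)
    πi′<πp = subst (λ z → toℕ (π ⟨$⟩ʳ i′) < toℕ z) (sym πp≡x)
      (≤∧≢⇒< (s≤s⁻¹ (subst (toℕ (π ⟨$⟩ʳ i′) <_) πi≡1+x πi′<πi))
        (λ πi′≡x → <-irrefl (cong toℕ (sym (toℕ∘π-injective (trans πi′≡x (cong toℕ (sym πp≡x))))))
                            (<-trans p<i (≤-reflexive (sym i′≡1+i)))))

module RunListing {n k} (π : Permutation′ n) (I : Fin k → Subset n)
                  (listing : IsOrderedInvDescentRuns π I) where

  open DescentRuns (π ⟨$⟩ˡ_) using (NoDescentBelow)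
  open InverseRuns π

  listed : ∀ j → IsInvDescentRun π (I j)
  listed = proj₁ listing

  listedRunMax : ∀ j → Σ (Fin n) (IsMax (I j))
  listedRunMax j = _ , invRun-max (listed j)

  listedRunThrough : ∀ x → Σ (Fin k) λ j → x ∈ I j
  listedRunThrough x =
    let S , ir , x∈S = invRunThrough x
        j , Ij≡S = proj₁ (proj₂ listing) S ir in
    j , subst (x ∈_) (sym Ij≡S) x∈S

  listedRunMax-antitone : ∀ {j j′ m m′} → j Fin.≤ j′ → IsMax (I j) m → IsMax (I j′) m′ → m′ Fin.≤ m
  listedRunMax-antitone j≤j′ m-max m′-max with m≤n⇒m<n∨m≡n j≤j′
  ... | inj₁ j<j′ = <⇒≤ (proj₂ (proj₂ listing) _ _ _ _ j<j′ m-max m′-max)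
  ... | inj₂ j≡j′ rewrite toℕ-injective j≡j′ = ≤-reflexive (cong toℕ (IsMax-unique m′-max m-max))

  listedRunMax⇔noDescentBelow : ∀ {x} → (Σ (Fin k) λ j → IsMax (I j) x) ⇔ NoDescentBelow (π ⟨$⟩ʳ x)
  listedRunMax⇔noDescentBelow {x} = mk⇔
    (λ (j , x-max) → to (invRun-max⇔noDescentBelow (listed j) (proj₁ x-max)) x-max)
    (λ noDescent → let j , x∈Ij = listedRunThrough x in
                   j , from (invRun-max⇔noDescentBelow (listed j) x∈Ij) noDescent)

  laterRunMax⇔notLast×runMax : ∀ {i} → (Σ (Fin k) λ j → 1 ≤ toℕ j × IsMax (I j) i) ⇔
    ((Σ (Fin n) λ i′ → toℕ i′ ≡ suc (toℕ i)) × (Σ (Fin k) λ j → IsMax (I j) i))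
  laterRunMax⇔notLast×runMax {i} = mk⇔ notLast×runMax laterRunMax
    where
    notLast×runMax : (Σ (Fin k) λ j → 1 ≤ toℕ j × IsMax (I j) i) →
      (Σ (Fin n) λ i′ → toℕ i′ ≡ suc (toℕ i)) × (Σ (Fin k) λ j → IsMax (I j) i)
    notLast×runMax (Fin.suc j , _ , i-max) =
      let m₀ , m₀-max = listedRunMax Fin.zero
          i<m₀ = proj₂ (proj₂ listing) Fin.zero (Fin.suc j) m₀ i (s≤s z≤n) m₀-max i-max
          1+i<n = ≤-<-trans i<m₀ (toℕ<n m₀) in
      (fromℕ< 1+i<n , toℕ-fromℕ< 1+i<n) , Fin.suc j , i-max
    laterRunMax : (Σ (Fin n) λ i′ → toℕ i′ ≡ suc (toℕ i)) × (Σ (Fin k) λ j → IsMax (I j) i) →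
      Σ (Fin k) λ j → 1 ≤ toℕ j × IsMax (I j) i
    laterRunMax (_ , Fin.suc j , i-max) = Fin.suc j , s≤s z≤n , i-max
    laterRunMax ((i′ , i′≡1+i) , Fin.zero , i-max) =
      let j′ , i′∈Ij′ = listedRunThrough i′
          m′ , m′-max = listedRunMax j′ in
      ⊥-elim (<⇒≱ (subst (_≤ toℕ m′) i′≡1+i (proj₂ m′-max i′ i′∈Ij′))
                  (listedRunMax-antitone z≤n i-max m′-max))

lemma3p3 : (n : ℕ) → 1 ≤ n → (π : Permutation′ n) → Avoids231 π →
    (k : ℕ) → (I : Fin k → Subset n) → IsOrderedInvDescentRuns π I →
    (i : Fin n) → IsAscent π i ⇔ (Σ (Fin k) λ j → 1 ≤ toℕ j × IsMax (I j) i)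
lemma3p3 n _ π avoids k I listing i = mk⇔
  (λ (i′ , i′≡1+i , πi<πi′) →
    from laterRunMax⇔notLast×runMax
      ((i′ , i′≡1+i) , from listedRunMax⇔noDescentBelow (ascent⇒noDescentBelow i′≡1+i πi<πi′)))
  (λ laterRunMax →
    let (i′ , i′≡1+i) , runMax = to laterRunMax⇔notLast×runMax laterRunMax in
    i′ , i′≡1+i , noDescentBelow⇒ascent i′≡1+i (to listedRunMax⇔noDescentBelow runMax))
  where
  open Avoiding231 π avoids
  open RunListing π I listing
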